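{- Let $A$ be a set with relations $<, \leq\, : A \to A \to \mathsf{hProp}$ satisfying: (A1) $<$ is transitive and irreflexive; (A2) $\leq$ is reflexive, transitive and antisymmetric; (A3) for all $a,b,c$, $b < a \to b \leq a$, and $c < b \to b \leq a \to c < a$. Let $s : A \to A$. Then $s$ calculates successors, i.e.\ $\forall b.\, s(b) \text{ is-suc-of } b$, if and only if for all $b, x : A$ we have $(b < x) \leftrightarrow (s(b) \leq x)$.
   Context: Work in homotopy type theory; $\mathsf{hProp}$ is the type of propositions. For $a,b : A$, $a \text{ is-suc-of } b := (b < a) \times \forall x.\,(b < x \to a \leq x)$. $\leftrightarrow$ denotes logical equivalence (functions in both directions). -}

module Defs where

open import Level using (Level; _⊔_)
open import Data.Product using (_×_; _,_)
open import Relation.Binary.PropositionalEquality using (_≡_)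
open import Data.Empty using (⊥)

isProp : ∀ {ℓ} → Set ℓ → Set ℓ
isProp P = (x y : P) → x ≡ y

isSet : ∀ {ℓ} → Set ℓ → Set ℓ
isSet A = (x y : A) → isProp (x ≡ y)

_↔_ : ∀ {ℓ ℓ'} → Set ℓ → Set ℓ' → Set (ℓ ⊔ ℓ')
P ↔ Q = (P → Q) × (Q → P)

is-suc-of : ∀ {ℓ ℓ<} {A : Set ℓ} (_<_ _≤_ : A → A → Set ℓ<) → A → A → Set (ℓ ⊔ ℓ<)
is-suc-of _<_ _≤_ a b = (b < a) × (∀ x → b < x → a ≤ x)

record Assumptions {ℓ ℓ<} (A : Set ℓ) (_<_ _≤_ : A → A → Set ℓ<) : Set (ℓ ⊔ ℓ<) where
  field
    A-isSet   : isSet A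
    <-isProp  : ∀ a b → isProp (a < b)
    ≤-isProp  : ∀ a b → isProp (a ≤ b)
    <-trans   : ∀ {a b c} → a < b → b < c → a < c
    <-irrefl  : ∀ {a} → a < a → ⊥
    ≤-refl    : ∀ {a} → a ≤ a
    ≤-trans   : ∀ {a b c} → a ≤ b → b ≤ c → a ≤ c
    ≤-antisym : ∀ {a b} → a ≤ b → b ≤ a → a ≡ b
    <⇒≤       : ∀ {a b} → b < a → b ≤ a
    <-≤-trans : ∀ {a b c} → c < b → b ≤ a → c < a

{-# OPTIONS --safe #-}
module Submission where

open import Defs
open import Data.Product using (_,_; proj₁; proj₂)

module _ {ℓ ℓ<} {A : Set ℓ} (_<_ _≤_ : A → A → Set ℓ<) where

  is-suc-of⇒<↔≤ : (∀ {a b c} → c < b → b ≤ a → c < a)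
    → ∀ {a b} → is-suc-of _<_ _≤_ a b → ∀ x → (b < x) ↔ (a ≤ x)
  is-suc-of⇒<↔≤ <-≤-trans (b<a , a-least) x = a-least x , <-≤-trans b<a

  <↔≤⇒is-suc-of : (∀ {a} → a ≤ a)
    → ∀ {a b} → (∀ x → (b < x) ↔ (a ≤ x)) → is-suc-of _<_ _≤_ a b
  <↔≤⇒is-suc-of ≤-refl <↔≤ = proj₂ (<↔≤ _) ≤-refl , λ x → proj₁ (<↔≤ x)

lemma4p6 : ∀ {ℓ ℓ<} {A : Set ℓ} {_<_ _≤_ : A → A → Set ℓ<}
    → Assumptions A _<_ _≤_
    → (s : A → A)
    → (∀ b → is-suc-of _<_ _≤_ (s b) b) ↔ (∀ b x → (b < x) ↔ (s b ≤ x))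
lemma4p6 {_<_ = _<_} {_≤_} H s =
    (λ s-suc b → is-suc-of⇒<↔≤ _<_ _≤_ <-≤-trans (s-suc b))
  , (λ <↔≤ b → <↔≤⇒is-suc-of _<_ _≤_ ≤-refl (<↔≤ b))
  where open Assumptions H
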